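{- Let $B$ be a non-trivial Boolean algebra and let $\mathscr K_{\max}=\{M\subseteq B: M\neq\emptyset,\ 0\notin M\}$. Then $\mathscr K_{\max}$ is an ultracontact on $B$, and $\mathscr K\subseteq\mathscr K_{\max}$ for every ultracontact $\mathscr K$ on $B$.
   Context: Let $B$ be a non-trivial Boolean algebra with order $\le$ and join $+$. For $F,G\subseteq B$ put $F+G=\{f+g: f\in F,\ g\in G\}$, and write $F\preceq G$ iff for every $g\in G$ there is $f\in F$ with $f\le g$. An ultracontact on $B$ is a family $\mathscr K\subseteq 2^B$ such that for all $F,G\subseteq B$: (K0) $\emptyset\notin\mathscr K$; (K1) if $0\in F$ then $F\notin\mathscr K$; (K2) if $x\neq 0$ then $\{x\}\in\mathscr K$; (K3) if $F\preceq G$, $G\neq\emptyset$ and $F\in\mathscr K$, then $G\in\mathscr K$; (K4) if $F+G\in\mathscr K$ then $F\in\mathscr K$ or $G\in\mathscr K$. -}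

module Defs where

open import Level using (Level; _⊔_; suc; Lift)
open import Algebra.Lattice.Bundles using (BooleanAlgebra)
open import Data.Product using (Σ; ∃; _×_; ∃-syntax)
open import Data.Sum using (_⊎_)
open import Data.Empty using () renaming (⊥ to False)
open import Relation.Nullary using (¬_)

module _ {c ℓ : Level} (B : BooleanAlgebra c ℓ) where
  open BooleanAlgebra B hiding (¬_)

  Subset : Set (suc (c ⊔ ℓ))
  Subset = Carrier → Set (c ⊔ ℓ)

  Family : Set (suc (c ⊔ ℓ))
  Family = Subset → Set (c ⊔ ℓ)

  _≤_ : Carrier → Carrier → Set ℓ
  x ≤ y = (x ∨ y) ≈ y

  ｛_｝ : Carrier → Subset
  ｛ x ｝ y = Lift c (y ≈ x)

  _⊕_ : Subset → Subset → Subset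
  (F ⊕ G) z = ∃[ f ] ∃[ g ] (F f × G g × z ≈ (f ∨ g))

  _≼_ : Subset → Subset → Set (c ⊔ ℓ)
  F ≼ G = ∀ g → G g → ∃[ f ] (F f × f ≤ g)

  IsEmpty : Subset → Set (c ⊔ ℓ)
  IsEmpty F = ∀ x → ¬ F x

  NonEmpty : Subset → Set (c ⊔ ℓ)
  NonEmpty F = ∃[ x ] F x

  ZeroIn : Subset → Set (c ⊔ ℓ)
  ZeroIn F = ∃[ f ] (F f × f ≈ ⊥)

  record IsUltracontact (𝒦 : Family) : Set (suc (c ⊔ ℓ)) where
    field
      K0 : ∀ F → IsEmpty F → ¬ 𝒦 F
      K1 : ∀ F → ZeroIn F → ¬ 𝒦 F
      K2 : ∀ x → ¬ (x ≈ ⊥) → 𝒦 ｛ x ｝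
      K3 : ∀ F G → F ≼ G → NonEmpty G → 𝒦 F → 𝒦 G
      K4 : ∀ F G → 𝒦 (F ⊕ G) → 𝒦 F ⊎ 𝒦 G

  Kmax : Family
  Kmax M = NonEmpty M × ¬ ZeroIn M

  NonTrivial : Set ℓ
  NonTrivial = ¬ (⊤ ≈ ⊥)

{-# OPTIONS --safe #-}
module Submission where

open import Defs
open import Level using (Level; _⊔_; lift)
open import Algebra.Lattice.Bundles using (BooleanAlgebra)
open import Axiom.ExcludedMiddle using (ExcludedMiddle)
open import Data.Product using (_×_; _,_)
open import Data.Sum using (_⊎_; inj₁; inj₂)
open import Relation.Nullary using (¬_; yes; no; contradiction)
open import Relation.Nullary.Decidable using (decidable-stable)
import Algebra.Lattice.Properties.BooleanAlgebra as BooleanAlgebraProperties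
import Relation.Binary.Reasoning.Setoid as SetoidReasoning

module _ {c ℓ : Level} (B : BooleanAlgebra c ℓ) where
  open BooleanAlgebra B hiding (¬_)
  open BooleanAlgebraProperties B using (∨-identityʳ)
  open SetoidReasoning setoid

  ≼-reflects-ZeroIn : ∀ {F G} → _≼_ B F G → ZeroIn B G → ZeroIn B F
  ≼-reflects-ZeroIn F≼G (g , Gg , g≈⊥) with F≼G g Gg
  ... | f , Ff , f≤g = f , Ff , (begin
    f      ≈⟨ sym (∨-identityʳ f) ⟩
    f ∨ ⊥  ≈⟨ ∨-cong refl (sym g≈⊥) ⟩
    f ∨ g  ≈⟨ f≤g ⟩
    g      ≈⟨ g≈⊥ ⟩
    ⊥      ∎)

  ZeroIn-⊕ : ∀ {F G} → ZeroIn B F → ZeroIn B G → ZeroIn B (_⊕_ B F G)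
  ZeroIn-⊕ (f , Ff , f≈⊥) (g , Gg , g≈⊥) = f ∨ g , (f , g , Ff , Gg , refl) , (begin
    f ∨ g  ≈⟨ ∨-cong f≈⊥ g≈⊥ ⟩
    ⊥ ∨ ⊥  ≈⟨ ∨-identityʳ ⊥ ⟩
    ⊥      ∎)

  NonEmpty-⊕ : ∀ {F G} → NonEmpty B (_⊕_ B F G) → NonEmpty B F × NonEmpty B G
  NonEmpty-⊕ (_ , f , g , Ff , Gg , _) = (f , Ff) , (g , Gg)

  ¬IsEmpty⇒NonEmpty : ExcludedMiddle (c ⊔ ℓ) → ∀ {M} → ¬ IsEmpty B M → NonEmpty B M
  ¬IsEmpty⇒NonEmpty em M≢∅ = decidable-stable em (λ ∄x → M≢∅ (λ x Mx → ∄x (x , Mx)))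

  Kmax-⊕ : ExcludedMiddle (c ⊔ ℓ) → ∀ {F G} → Kmax B (_⊕_ B F G) → Kmax B F ⊎ Kmax B G
  Kmax-⊕ em {F} {G} (F⊕G≢∅ , 0∉F⊕G) with NonEmpty-⊕ F⊕G≢∅ | em {ZeroIn B F} | em {ZeroIn B G}
  ... | F≢∅ , _   | no 0∉F  | _       = inj₁ (F≢∅ , 0∉F)
  ... | _   , G≢∅ | yes _   | no 0∉G  = inj₂ (G≢∅ , 0∉G)
  ... | _         | yes 0∈F | yes 0∈G = contradiction (ZeroIn-⊕ 0∈F 0∈G) 0∉F⊕G

  Kmax-isUltracontact : ExcludedMiddle (c ⊔ ℓ) → IsUltracontact B (Kmax B)
  Kmax-isUltracontact em = record
    { K0 = λ _ M≡∅ (M≢∅ , _) → let x , Mx = M≢∅ in M≡∅ x Mx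
    ; K1 = λ _ 0∈M (_ , 0∉M) → 0∉M 0∈M
    ; K2 = λ x x≉⊥ → (x , lift refl) , λ { (_ , lift y≈x , y≈⊥) → x≉⊥ (trans (sym y≈x) y≈⊥) }
    ; K3 = λ _ _ F≼G G≢∅ (_ , 0∉F) → G≢∅ , λ 0∈G → 0∉F (≼-reflects-ZeroIn F≼G 0∈G)
    ; K4 = λ _ _ → Kmax-⊕ em
    }

  ultracontact⊆Kmax : ExcludedMiddle (c ⊔ ℓ) → ∀ {𝒦} → IsUltracontact B 𝒦 → ∀ M → 𝒦 M → Kmax B M
  ultracontact⊆Kmax em 𝒦-ultra M M∈𝒦 =
    ¬IsEmpty⇒NonEmpty em (λ M≡∅ → K0 M M≡∅ M∈𝒦) , λ 0∈M → K1 M 0∈M M∈𝒦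
    where open IsUltracontact 𝒦-ultra

theorem4p5 : {c ℓ : Level} → ExcludedMiddle (c ⊔ ℓ) → (B : BooleanAlgebra c ℓ) → NonTrivial B →
    IsUltracontact B (Kmax B) × (∀ 𝒦 → IsUltracontact B 𝒦 → ∀ M → 𝒦 M → Kmax B M)
theorem4p5 em B _ = Kmax-isUltracontact B em , λ _ 𝒦-ultra → ultracontact⊆Kmax B em 𝒦-ultra
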